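{- Let $S$ be a species tree with $n \geq 1$ leaves, and let $\mathcal{G}_1, \mathcal{G}_2 \in \mathsf{G}^S$. Then $d_{path}(\mathcal{G}_1, \mathcal{G}_2) \leq H(S) \leq (n-1)(n-2)/2$.
   Context: All trees are rooted; $L(T)$ is the leaf set, $L(T(v))$ the leaves descending from $v$, $\mathrm{lca}_T$ lowest common ancestor, $r(T)$ the root, $dist_T$ path length in edges. A species tree $S$ is a rooted binary tree. A reconciled gene tree is a tuple $\mathcal{G} = (G, S, \mu, l)$ where $G$ is a rooted tree in which every internal node has at least two children, $\mu : V(G) \to V(S)$, $l : V(G) \to \{dup, spec, extant\}$, such that: (1) leaves map to leaves of $S$ and have label $extant$, internal nodes have label $dup$ or $spec$; (2) $u \preceq_G v$ implies $\mu(u) \preceq_S \mu(v)$; (3) if $l(v) = spec$ then $\mu(v)$ is internal in $S$, $v$ has exactly two children $v_1,v_2$, and with $s_1,s_2$ the children of $\mu(v)$, either $\mu(v_1) \preceq_S s_1, \mu(v_2) \preceq_S s_2$ or $\mu(v_2) \preceq_S s_1, \mu(v_1) \preceq_S s_2$. $\mathsf{G}^S$ is the set of reconciled gene trees $(G, S, \mu, l)$ such that for each $s \in L(S)$ exactly one leaf $x$ of $G$ has $\mu(x) = s$; leaves are identified by their species, so all elements of $\mathsf{G}^S$ have the same leaf set and leaves with the same identity map to the same species. For $\mathcal{G}_1 = (G_1,S,\mu_1,l_1), \mathcal{G}_2 = (G_2,S,\mu_2,l_2)$ and $v \in V(G_1)$, $m(v) = \mathrm{lca}_{G_2}(L(G_1(v)))$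 and $d_{path}(\mathcal{G}_1,\mathcal{G}_2) = \sum_{v \in V(G_1)} dist_S(\mu_1(v), \mu_2(m(v)))$. $H(S) = \sum_{v \in V(S) \setminus L(S)} dist_S(v, r(S))$. -}

module Defs where

open import Data.Nat using (ℕ; zero; suc; _+_; _∸_; _≟_)
open import Data.List using (List; []; _∷_; _++_; [_]; map; length; foldr; filter)
open import Data.Nat.ListAction using (sum)
open import Data.List.Properties using (≡-dec)
open import Data.Maybe using (Maybe; just; nothing; maybe)
open import Data.Product using (Σ; ∃; _×_; _,_)
open import Data.Sum using (_⊎_)
open import Relation.Binary.PropositionalEquality using (_≡_; _≢_)
open import Relation.Nullary using (¬_)
import Data.List.Membership.DecPropositional as DecMem

-- Rooted (rose) trees.  A node is identified by its position: the list of
-- child indices on the path from the root.  The root is [].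

data RTree : Set where
  node : List RTree → RTree

Pos : Set
Pos = List ℕ

mutual
  sub : RTree → Pos → Maybe RTree
  sub t [] = just t
  sub (node ts) (i ∷ p) = subL ts i p

  subL : List RTree → ℕ → Pos → Maybe RTree
  subL [] _ _ = nothing
  subL (t ∷ ts) zero p = sub t p
  subL (t ∷ ts) (suc i) p = subL ts i p

IsNode : RTree → Pos → Set
IsNode t p = ∃ λ t' → sub t p ≡ just t'

IsLeaf : RTree → Pos → Set
IsLeaf t p = sub t p ≡ just (node [])

IsInternal : RTree → Pos → Set
IsInternal t p = ∃ λ ts → sub t p ≡ just (node ts) × ts ≢ []

IsBinary : RTree → Set
IsBinary t = ∀ p ts → sub t p ≡ just (node ts) → length ts ≡ 0 ⊎ length ts ≡ 2

IsGeneShape : RTree → Set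
IsGeneShape t = ∀ p ts → sub t p ≡ just (node ts) → length ts ≡ 0 ⊎ 2 Data.Nat.≤ length ts

mutual
  positions : RTree → List Pos
  positions (node ts) = [] ∷ positionsL 0 ts

  positionsL : ℕ → List RTree → List Pos
  positionsL i [] = []
  positionsL i (t ∷ ts) = map (i ∷_) (positions t) ++ positionsL (suc i) ts

mutual
  leavesOf : RTree → List Pos
  leavesOf (node []) = [ [] ]
  leavesOf (node (t ∷ ts)) = leavesL 0 (t ∷ ts)

  leavesL : ℕ → List RTree → List Pos
  leavesL i [] = []
  leavesL i (t ∷ ts) = map (i ∷_) (leavesOf t) ++ leavesL (suc i) ts

mutual
  internalsOf : RTree → List Pos
  internalsOf (node []) = []
  internalsOf (node (t ∷ ts)) = [] ∷ internalsL 0 (t ∷ ts)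

  internalsL : ℕ → List RTree → List Pos
  internalsL i [] = []
  internalsL i (t ∷ ts) = map (i ∷_) (internalsOf t) ++ internalsL (suc i) ts

leavesBelow : RTree → Pos → List Pos
leavesBelow t v = map (v ++_) (maybe leavesOf [] (sub t v))

_⪯_ : Pos → Pos → Set
u ⪯ v = ∃ λ w → v ++ w ≡ u

-- longest common prefix = position of the lca of two nodes
lcp : Pos → Pos → Pos
lcp [] _ = []
lcp (_ ∷ _) [] = []
lcp (a ∷ p) (b ∷ q) with a ≟ b
... | Relation.Nullary.yes _ = a ∷ lcp p q
... | Relation.Nullary.no _ = []

lcaL : List Pos → Pos
lcaL [] = []
lcaL (p ∷ ps) = foldr lcp p ps

dist : Pos → Pos → ℕ
dist u v = (length u ∸ length (lcp u v)) + (length v ∸ length (lcp u v))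

H : RTree → ℕ
H s = sum (map length (internalsOf s))

data Label : Set where
  dup spec extant : Label

record Reconciled (S : RTree) : Set where
  field
    G : RTree
    G-shape : IsGeneShape G
    μ : Pos → Pos
    l : Pos → Label
    μ-node : ∀ v → IsNode G v → IsNode S (μ v)
    leaf-μ : ∀ v → IsLeaf G v → IsLeaf S (μ v)
    leaf-l : ∀ v → IsLeaf G v → l v ≡ extant
    internal-l : ∀ v → IsInternal G v → l v ≡ dup ⊎ l v ≡ spec
    μ-mono : ∀ u v → IsNode G u → IsNode G v → u ⪯ v → μ u ⪯ μ v
    spec-cond : ∀ v → IsNode G v → l v ≡ spec →
      IsInternal S (μ v)
      × (∃ λ ts → sub G v ≡ just (node ts) × length ts ≡ 2)
      × ((μ (v ++ [ 0 ]) ⪯ (μ v ++ [ 0 ]) × μ (v ++ [ 1 ]) ⪯ (μ v ++ [ 1 ]))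
         ⊎ (μ (v ++ [ 1 ]) ⪯ (μ v ++ [ 0 ]) × μ (v ++ [ 0 ]) ⪯ (μ v ++ [ 1 ])))

open Reconciled public

InGS : {S : RTree} → Reconciled S → Set
InGS {S} 𝒢 = ∀ s → IsLeaf S s →
  ∃ λ x → IsLeaf (G 𝒢) x × μ 𝒢 x ≡ s
          × (∀ y → IsLeaf (G 𝒢) y → μ 𝒢 y ≡ s → y ≡ x)

open DecMem (≡-dec _≟_) using (_∈?_)

-- m(v) = lca_{G₂}(L(G₁(v))), leaves being identified by their species
mMap : {S : RTree} → Reconciled S → Reconciled S → Pos → Pos
mMap 𝒢₁ 𝒢₂ v =
  lcaL (filter (λ x → μ 𝒢₂ x ∈? map (μ 𝒢₁) (leavesBelow (G 𝒢₁) v))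
               (leavesOf (G 𝒢₂)))

dpath : {S : RTree} → Reconciled S → Reconciled S → ℕ
dpath 𝒢₁ 𝒢₂ =
  sum (map (λ v → dist (μ 𝒢₁ v) (μ 𝒢₂ (mMap 𝒢₁ 𝒢₂ v))) (positions (G 𝒢₁)))

-- For a node v of G₁, both μ₁(v) and μ₂(m(v)) are ancestors of every species below v, so they are
-- comparable and their distance is at most the depth of the lca in S of those species (for a leaf v it is 0).
-- That depth counts the internal nodes u of S whose child subtree contains all these species. Charging each
-- internal node v of G₁ to those u: since the species of G₁ are distinct and every internal node of G₁ has at
-- least two children, a child subtree c of u receives at most |L(c)| - 1 charges, which is the number of
-- internal nodes of c. Summing over u gives the sum over all internal nodes of S of their depths, i.e. H(S).
-- Finally, S has n - 1 internal nodes and an induction over S gives 2 H(S) ≤ (n - 1)(n - 2).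

module Submission where

open import Defs
open import Data.List using (List; []; _∷_; _++_; [_]; length; map; foldr; filter; catMaybes; mapMaybe)
open import Data.List.Membership.Propositional using (_∈_)
open import Data.List.Membership.Propositional.Properties
  using (∈-map⁺; ∈-map⁻; ∈-++⁺ˡ; ∈-++⁺ʳ; ∈-++⁻; ∈-∃++; ∈-filter⁺; ∈-filter⁻)
open import Data.List.Properties
  using (≡-dec; ++-assoc; ++-identityʳ; map-++; map-∘; length-++; length-map; ∷-injectiveˡ; ∷-injectiveʳ;
         catMaybes-++; mapMaybe-just; mapMaybe-map)
open import Data.List.Relation.Binary.Subset.Propositional using (_⊆_)
open import Data.List.Relation.Unary.All as All using (All; []; _∷_)
import Data.List.Relation.Unary.All.Properties as All
open import Data.List.Relation.Unary.Any using (here; there)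
open import Data.List.Relation.Unary.Unique.Propositional using (Unique; []; _∷_)
import Data.List.Relation.Unary.Unique.Propositional.Properties as Unique
open import Data.Maybe using (Maybe; just; nothing; maybe; _>>=_)
open import Data.Nat using (ℕ; zero; suc; _+_; _*_; _∸_; _⊔_; _≤_; _≟_; z≤n; s≤s)
open import Data.Nat.ListAction using (sum)
open import Data.Nat.ListAction.Properties using (sum-++)
open import Data.Nat.Properties
open import Data.Nat.Tactic.RingSolver using (solve-∀)
open import Data.Product using (_×_; ∃; ∃₂; _,_; proj₁; proj₂)
open import Data.Sum using (_⊎_; inj₁; inj₂)
open import Function using (_∘_)
open import Relation.Binary.PropositionalEquality
  using (_≡_; _≢_; refl; sym; trans; cong; cong₂; subst; module ≡-Reasoning)
open import Relation.Nullary using (¬_; yes; no; contradiction)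
open import Data.List.Membership.DecPropositional (≡-dec _≟_) using (_∈?_)
open import Algebra.Properties.CommutativeSemigroup +-commutativeSemigroup using (interchange; x∙yz≈y∙xz)

∈⇒1≤length : ∀ {A : Set} {x : A} {xs} → x ∈ xs → 1 ≤ length xs
∈⇒1≤length (here _) = s≤s z≤n
∈⇒1≤length (there _) = s≤s z≤n

sum-mono-≤ : ∀ {A : Set} {f g : A → ℕ} xs → (∀ {x} → x ∈ xs → f x ≤ g x) →
  sum (map f xs) ≤ sum (map g xs)
sum-mono-≤ [] _ = z≤n
sum-mono-≤ (x ∷ xs) f≤g = +-mono-≤ (f≤g (here refl)) (sum-mono-≤ xs (f≤g ∘ there))

Unique-map⁺ : ∀ {A B : Set} {f : A → B} {xs} →
  (∀ {x y} → x ∈ xs → y ∈ xs → f x ≡ f y → x ≡ y) → Unique xs → Unique (map f xs)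
Unique-map⁺ {xs = []} _ [] = []
Unique-map⁺ {xs = x ∷ xs} inj (x≢xs ∷ uniq) =
  All.map⁺ (All.tabulate λ y∈ fx≡fy → All.lookup x≢xs y∈ (inj (here refl) (there y∈) fx≡fy))
  ∷ Unique-map⁺ (λ x∈ y∈ → inj (there x∈) (there y∈)) uniq

Unique-length-≤ : ∀ {A : Set} {xs ys : List A} → Unique xs → xs ⊆ ys → length xs ≤ length ys
Unique-length-≤ {xs = []} _ _ = z≤n
Unique-length-≤ {xs = x ∷ xs} (x≢xs ∷ uniq) xs⊆ys with us , vs , refl ← ∈-∃++ (xs⊆ys (here refl)) = begin
  suc (length xs)          ≤⟨ s≤s (Unique-length-≤ uniq xs⊆us++vs) ⟩
  suc (length (us ++ vs))  ≡⟨ cong suc (length-++ us) ⟩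
  suc (length us + length vs) ≡⟨ +-suc (length us) (length vs) ⟨
  length us + length (x ∷ vs) ≡⟨ length-++ us ⟨
  length (us ++ x ∷ vs)    ∎
  where
  open ≤-Reasoning
  xs⊆us++vs : xs ⊆ us ++ vs
  xs⊆us++vs y∈ with ∈-++⁻ us (xs⊆ys (there y∈))
  ... | inj₁ y∈us = ∈-++⁺ˡ y∈us
  ... | inj₂ (here refl) = contradiction refl (All.lookup x≢xs y∈)
  ... | inj₂ (there y∈vs) = ∈-++⁺ʳ us y∈vs

∈-mapMaybe⁻ : ∀ {A B : Set} (f : A → Maybe B) xs {y} → y ∈ mapMaybe f xs →
  ∃ λ x → x ∈ xs × f x ≡ just y
∈-mapMaybe⁻ f (x ∷ xs) y∈ with f x in eq | y∈
... | just _ | here refl = x , here refl , eq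
... | just _ | there y∈xs = let x' , x'∈ , eq' = ∈-mapMaybe⁻ f xs y∈xs in x' , there x'∈ , eq'
... | nothing | y∈xs = let x' , x'∈ , eq' = ∈-mapMaybe⁻ f xs y∈xs in x' , there x'∈ , eq'

Unique-mapMaybe⁺ : ∀ {A B : Set} (f : A → Maybe B) → (∀ {x y z} → f x ≡ just z → f y ≡ just z → x ≡ y) →
  ∀ {xs} → Unique xs → Unique (mapMaybe f xs)
Unique-mapMaybe⁺ f inj {[]} [] = []
Unique-mapMaybe⁺ f inj {x ∷ xs} (x≢xs ∷ uniq) with f x in eq
... | nothing = Unique-mapMaybe⁺ f inj uniq
... | just y = All.tabulate y≢ ∷ Unique-mapMaybe⁺ f inj uniq
  where
  y≢ : ∀ {y'} → y' ∈ mapMaybe f xs → y ≢ y'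
  y≢ y'∈ refl = let x' , x'∈ , eq' = ∈-mapMaybe⁻ f xs y'∈ in All.lookup x≢xs x'∈ (inj eq eq')

⪯-refl : ∀ p → p ⪯ p
⪯-refl p = [] , ++-identityʳ p

⪯-trans : ∀ {p q r} → p ⪯ q → q ⪯ r → p ⪯ r
⪯-trans {r = r} (w , refl) (w' , refl) = w' ++ w , sym (++-assoc r w' w)

lcp-∷ : ∀ i p q → lcp (i ∷ p) (i ∷ q) ≡ i ∷ lcp p q
lcp-∷ i p q with i ≟ i
... | yes _ = refl
... | no i≢i = contradiction refl i≢i

lcp-idem : ∀ p → lcp p p ≡ p
lcp-idem [] = refl
lcp-idem (i ∷ p) = trans (lcp-∷ i p p) (cong (i ∷_) (lcp-idem p))

lcp-⪯ : ∀ p q → p ⪯ lcp p q × q ⪯ lcp p q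
lcp-⪯ [] q = ([] , refl) , (q , refl)
lcp-⪯ (i ∷ p) [] = (i ∷ p , refl) , ([] , refl)
lcp-⪯ (i ∷ p) (j ∷ q) with i ≟ j
... | yes refl = let (w , e) , (w' , e') = lcp-⪯ p q in (w , cong (i ∷_) e) , (w' , cong (i ∷_) e')
... | no _ = (i ∷ p , refl) , (j ∷ q , refl)

foldr-lcp-⪯ : ∀ p qs → p ⪯ foldr lcp p qs × All (_⪯ foldr lcp p qs) qs
foldr-lcp-⪯ p [] = ⪯-refl p , []
foldr-lcp-⪯ p (q ∷ qs) =
  let p⪯ , qs⪯ = foldr-lcp-⪯ p qs
      q⪯ , rest⪯ = lcp-⪯ q (foldr lcp p qs)
  in ⪯-trans p⪯ rest⪯ , q⪯ ∷ All.map (λ ⪯rest → ⪯-trans ⪯rest rest⪯) qs⪯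

lcaL-⪯ : ∀ {p} ps → p ∈ ps → p ⪯ lcaL ps
lcaL-⪯ (p ∷ qs) (here refl) = proj₁ (foldr-lcp-⪯ p qs)
lcaL-⪯ (p ∷ qs) (there p∈qs) = All.lookup (proj₂ (foldr-lcp-⪯ p qs)) p∈qs

foldr-lcp-const : ∀ p qs → All (_≡ p) qs → foldr lcp p qs ≡ p
foldr-lcp-const p [] [] = refl
foldr-lcp-const p (q ∷ qs) (refl ∷ qs≡p) = trans (cong (lcp p) (foldr-lcp-const p qs qs≡p)) (lcp-idem p)

lcaL-const : ∀ {p} ps → p ∈ ps → (∀ {q} → q ∈ ps → q ≡ p) → lcaL ps ≡ p
lcaL-const (q ∷ qs) _ ps≡p with refl ← ps≡p (here refl) = foldr-lcp-const q qs (All.tabulate (ps≡p ∘ there))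

dist-refl : ∀ p → dist p p ≡ 0
dist-refl p rewrite lcp-idem p | n∸n≡0 (length p) = refl

-- Two prefixes of a common position are comparable, so their distance is the difference of their lengths.
dist≤⊔ : ∀ {r} p q → r ⪯ p → r ⪯ q → dist p q ≤ length p ⊔ length q
dist≤⊔ [] q _ _ = ≤-refl
dist≤⊔ (i ∷ p) [] _ _ = ≤-reflexive (+-identityʳ _)
dist≤⊔ (i ∷ p) (j ∷ q) (w , refl) (w' , eq) with refl ← ∷-injectiveˡ eq rewrite lcp-∷ i p q =
  m≤n⇒m≤1+n (dist≤⊔ p q (w , refl) (w' , ∷-injectiveʳ eq))

All-⪯-∷ : ∀ {i a} ps → All (_⪯ (i ∷ a)) ps → ∃ λ qs → ps ≡ map (i ∷_) qs
All-⪯-∷ [] [] = [] , refl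
All-⪯-∷ {a = a} (p ∷ ps) ((w , refl) ∷ ps⪯) =
  let qs , eq = All-⪯-∷ ps ps⪯ in (a ++ w) ∷ qs , cong (p ∷_) eq

⪯-∷⁻ : ∀ {i p q} → (i ∷ p) ⪯ (i ∷ q) → p ⪯ q
⪯-∷⁻ (w , eq) = w , ∷-injectiveʳ eq

mutual
  sub-++ : ∀ t p q → sub t (p ++ q) ≡ (sub t p >>= λ t' → sub t' q)
  sub-++ t [] q = refl
  sub-++ (node ts) (i ∷ p) q = subL-++ ts i p q

  subL-++ : ∀ ts i p q → subL ts i (p ++ q) ≡ (subL ts i p >>= λ t' → sub t' q)
  subL-++ [] i p q = refl
  subL-++ (t ∷ ts) zero p q = sub-++ t p q
  subL-++ (t ∷ ts) (suc i) p q = subL-++ ts i p q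

sub-++-just : ∀ t p q {t'} → sub t p ≡ just t' → sub t (p ++ q) ≡ sub t' q
sub-++-just t p q eq rewrite sub-++ t p q | eq = refl

IsNode-prefix : ∀ t p q → IsNode t (p ++ q) → IsNode t p
IsNode-prefix t p q (u , eq) with sub t p | sub-++ t p q
... | just t' | _ = t' , refl
... | nothing | eq' with () ← trans (sym eq') eq

mutual
  ∈-leavesOf⁻ : ∀ t {p} → p ∈ leavesOf t → IsLeaf t p
  ∈-leavesOf⁻ (node []) (here refl) = refl
  ∈-leavesOf⁻ (node (t ∷ ts)) p∈ with ∈-leavesL⁻ 0 (t ∷ ts) p∈
  ... | k , p' , refl , leaf = leaf

  ∈-leavesL⁻ : ∀ j ts {p} → p ∈ leavesL j ts →
    ∃₂ λ k p' → p ≡ (j + k) ∷ p' × subL ts k p' ≡ just (node [])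
  ∈-leavesL⁻ j (t ∷ ts) p∈ with ∈-++⁻ (map (j ∷_) (leavesOf t)) p∈
  ... | inj₁ p∈t with p' , p'∈ , refl ← ∈-map⁻ (j ∷_) p∈t =
    0 , p' , cong (_∷ p') (sym (+-identityʳ j)) , ∈-leavesOf⁻ t p'∈
  ... | inj₂ p∈ts with k , p' , refl , leaf ← ∈-leavesL⁻ (suc j) ts p∈ts =
    suc k , p' , cong (_∷ p') (sym (+-suc j k)) , leaf

mutual
  ∈-leavesOf⁺ : ∀ t {p} → IsLeaf t p → p ∈ leavesOf t
  ∈-leavesOf⁺ (node []) {[]} refl = here refl
  ∈-leavesOf⁺ (node (t ∷ ts)) {i ∷ p} leaf = ∈-leavesL⁺ 0 (t ∷ ts) i leaf

  ∈-leavesL⁺ : ∀ j ts i {p} → subL ts i p ≡ just (node []) → (j + i) ∷ p ∈ leavesL j ts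
  ∈-leavesL⁺ j (t ∷ ts) zero {p} leaf rewrite +-identityʳ j =
    ∈-++⁺ˡ (∈-map⁺ (j ∷_) (∈-leavesOf⁺ t leaf))
  ∈-leavesL⁺ j (t ∷ ts) (suc i) {p} leaf rewrite +-suc j i =
    ∈-++⁺ʳ (map (j ∷_) (leavesOf t)) (∈-leavesL⁺ (suc j) ts i leaf)

mutual
  leavesOf-unique : ∀ t → Unique (leavesOf t)
  leavesOf-unique (node []) = [] ∷ []
  leavesOf-unique (node (t ∷ ts)) = leavesL-unique 0 (t ∷ ts)

  leavesL-unique : ∀ j ts → Unique (leavesL j ts)
  leavesL-unique j [] = []
  leavesL-unique j (t ∷ ts) =
    Unique.++⁺ (Unique.map⁺ ∷-injectiveʳ (leavesOf-unique t)) (leavesL-unique (suc j) ts) disjoint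
    where
    disjoint : ∀ {p} → ¬ (p ∈ map (j ∷_) (leavesOf t) × p ∈ leavesL (suc j) ts)
    disjoint (p∈t , p∈ts)
      with _ , _ , refl ← ∈-map⁻ (j ∷_) p∈t | k , _ , eq , _ ← ∈-leavesL⁻ (suc j) ts p∈ts =
      1+n≰n (≤-trans (s≤s (m≤m+n j k)) (≤-reflexive (sym (∷-injectiveˡ eq))))

leavesOf-nonempty : ∀ t → ∃ (_∈ leavesOf t)
leavesOf-nonempty (node []) = [] , here refl
leavesOf-nonempty (node (t ∷ ts)) =
  let p , p∈ = leavesOf-nonempty t in 0 ∷ p , ∈-++⁺ˡ (∈-map⁺ (0 ∷_) p∈)

mutual
  nodes : RTree → List (Pos × RTree)
  nodes (node ts) = ([] , node ts) ∷ nodesL 0 ts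

  nodesL : ℕ → List RTree → List (Pos × RTree)
  nodesL j [] = []
  nodesL j (t ∷ ts) = map (λ (p , u) → j ∷ p , u) (nodes t) ++ nodesL (suc j) ts

mutual
  map-proj₁-nodes : ∀ t → map proj₁ (nodes t) ≡ positions t
  map-proj₁-nodes (node ts) = cong ([] ∷_) (map-proj₁-nodesL 0 ts)

  map-proj₁-nodesL : ∀ j ts → map proj₁ (nodesL j ts) ≡ positionsL j ts
  map-proj₁-nodesL j [] = refl
  map-proj₁-nodesL j (t ∷ ts) = begin
    map proj₁ (map _ (nodes t) ++ nodesL (suc j) ts)
      ≡⟨ map-++ proj₁ (map _ (nodes t)) (nodesL (suc j) ts) ⟩
    map proj₁ (map _ (nodes t)) ++ map proj₁ (nodesL (suc j) ts)
      ≡⟨ cong₂ _++_ (trans (sym (map-∘ (nodes t))) (map-∘ (nodes t))) (map-proj₁-nodesL (suc j) ts) ⟩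
    map (j ∷_) (map proj₁ (nodes t)) ++ positionsL (suc j) ts
      ≡⟨ cong (λ ps → map (j ∷_) ps ++ positionsL (suc j) ts) (map-proj₁-nodes t) ⟩
    map (j ∷_) (positions t) ++ positionsL (suc j) ts ∎
    where open ≡-Reasoning

mutual
  ∈-nodes⁻ : ∀ t {p u} → (p , u) ∈ nodes t → sub t p ≡ just u
  ∈-nodes⁻ (node ts) (here refl) = refl
  ∈-nodes⁻ (node ts) (there p∈) with k , p' , refl , eq ← ∈-nodesL⁻ 0 ts p∈ = eq

  ∈-nodesL⁻ : ∀ j ts {p u} → (p , u) ∈ nodesL j ts →
    ∃₂ λ k p' → p ≡ (j + k) ∷ p' × subL ts k p' ≡ just u
  ∈-nodesL⁻ j (t ∷ ts) p∈ with ∈-++⁻ (map _ (nodes t)) p∈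
  ... | inj₁ p∈t with (p' , _) , p'∈ , refl ← ∈-map⁻ _ p∈t =
    0 , p' , cong (_∷ p') (sym (+-identityʳ j)) , ∈-nodes⁻ t p'∈
  ... | inj₂ p∈ts with k , p' , refl , eq ← ∈-nodesL⁻ (suc j) ts p∈ts =
    suc k , p' , cong (_∷ p') (sym (+-suc j k)) , eq

data BinaryView : RTree → Set where
  leaf : BinaryView (node [])
  node : ∀ A B → IsBinary A → IsBinary B → BinaryView (node (A ∷ B ∷ []))

binaryView : ∀ t → IsBinary t → BinaryView t
binaryView (node []) _ = leaf
binaryView (node (A ∷ [])) bin with bin [] (A ∷ []) refl
... | inj₁ ()
... | inj₂ ()
binaryView (node (A ∷ B ∷ [])) bin = node A B (bin ∘ (0 ∷_)) (bin ∘ (1 ∷_))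
binaryView (node (A ∷ B ∷ C ∷ ts)) bin with bin [] (A ∷ B ∷ C ∷ ts) refl
... | inj₁ ()
... | inj₂ ()

length-children : ∀ (ps qs : List Pos) → length (map (0 ∷_) ps ++ map (1 ∷_) qs ++ []) ≡ length ps + length qs
length-children ps qs = begin
  length (map (0 ∷_) ps ++ map (1 ∷_) qs ++ [])
    ≡⟨ length-++ (map (0 ∷_) ps) ⟩
  length (map (0 ∷_) ps) + length (map (1 ∷_) qs ++ [])
    ≡⟨ cong₂ _+_ (length-map (0 ∷_) ps) (cong length (++-identityʳ (map (1 ∷_) qs))) ⟩
  length ps + length (map (1 ∷_) qs)
    ≡⟨ cong (length ps +_) (length-map (1 ∷_) qs) ⟩
  length ps + length qs ∎
  where open ≡-Reasoning

sum-length-map-∷ : ∀ i (ps : List Pos) → sum (map length (map (i ∷_) ps)) ≡ length ps + sum (map length ps)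
sum-length-map-∷ i [] = refl
sum-length-map-∷ i (p ∷ ps) rewrite sum-length-map-∷ i ps =
  cong suc (x∙yz≈y∙xz (length p) (length ps) (sum (map length ps)))

H-node : ∀ A B → H (node (A ∷ B ∷ [])) ≡ (length (internalsOf A) + H A) + (length (internalsOf B) + H B)
H-node A B = begin
  sum (map length (map (0 ∷_) (internalsOf A) ++ map (1 ∷_) (internalsOf B) ++ []))
    ≡⟨ cong (λ ps → sum (map length (map (0 ∷_) (internalsOf A) ++ ps))) (++-identityʳ _) ⟩
  sum (map length (map (0 ∷_) (internalsOf A) ++ map (1 ∷_) (internalsOf B)))
    ≡⟨ cong sum (map-++ length (map (0 ∷_) (internalsOf A)) _) ⟩
  sum (map length (map (0 ∷_) (internalsOf A)) ++ map length (map (1 ∷_) (internalsOf B)))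
    ≡⟨ sum-++ (map length (map (0 ∷_) (internalsOf A))) _ ⟩
  sum (map length (map (0 ∷_) (internalsOf A))) + sum (map length (map (1 ∷_) (internalsOf B)))
    ≡⟨ cong₂ _+_ (sum-length-map-∷ 0 (internalsOf A)) (sum-length-map-∷ 1 (internalsOf B)) ⟩
  (length (internalsOf A) + H A) + (length (internalsOf B) + H B) ∎
  where open ≡-Reasoning

suc-#internals≡#leaves : ∀ t → IsBinary t → suc (length (internalsOf t)) ≡ length (leavesOf t)
suc-#internals≡#leaves t bin with binaryView t bin
... | leaf = refl
... | node A B binA binB = begin
  suc (suc (length (map (0 ∷_) (internalsOf A) ++ map (1 ∷_) (internalsOf B) ++ [])))
    ≡⟨ cong (suc ∘ suc) (length-children (internalsOf A) (internalsOf B)) ⟩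
  suc (suc (length (internalsOf A) + length (internalsOf B)))
    ≡⟨ cong suc (sym (+-suc _ _)) ⟩
  suc (length (internalsOf A)) + suc (length (internalsOf B))
    ≡⟨ cong₂ _+_ (suc-#internals≡#leaves A binA) (suc-#internals≡#leaves B binB) ⟩
  length (leavesOf A) + length (leavesOf B)
    ≡⟨ sym (length-children (leavesOf A) (leavesOf B)) ⟩
  length (map (0 ∷_) (leavesOf A) ++ map (1 ∷_) (leavesOf B) ++ []) ∎
  where open ≡-Reasoning

2*H≤#internals*pred : ∀ t → IsBinary t → let k = length (internalsOf t) in 2 * H t ≤ k * (k ∸ 1)
2*H≤#internals*pred t bin with binaryView t bin
... | leaf = z≤n
... | node A B binA binB rewrite H-node A B | length-children (internalsOf A) (internalsOf B) = begin
  2 * ((a + H A) + (b + H B))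
    ≡⟨ regroup a b (H A) (H B) ⟩
  (2 * H A + 2 * a) + (2 * H B + 2 * b)
    ≤⟨ +-mono-≤ (+-monoˡ-≤ (2 * a) (2*H≤#internals*pred A binA))
                (+-monoˡ-≤ (2 * b) (2*H≤#internals*pred B binB)) ⟩
  (a * (a ∸ 1) + 2 * a) + (b * (b ∸ 1) + 2 * b)
    ≡⟨ cong₂ _+_ (n*[n∸1]+2n≡n*[n+1] a) (n*[n∸1]+2n≡n*[n+1] b) ⟩
  a * (a + 1) + b * (b + 1)
    ≤⟨ m≤m+n _ (2 * (a * b)) ⟩
  a * (a + 1) + b * (b + 1) + 2 * (a * b)
    ≡⟨ square a b ⟩
  suc (a + b) * (a + b) ∎
  where
  open ≤-Reasoning
  a = length (internalsOf A)
  b = length (internalsOf B)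
  n*[n∸1]+2n≡n*[n+1] : ∀ n → n * (n ∸ 1) + 2 * n ≡ n * (n + 1)
  n*[n∸1]+2n≡n*[n+1] zero = refl
  n*[n∸1]+2n≡n*[n+1] (suc n) = suc-case n
    where
    suc-case : ∀ n → suc n * n + 2 * suc n ≡ suc n * (suc n + 1)
    suc-case = solve-∀
  regroup : ∀ a b x y → 2 * ((a + x) + (b + y)) ≡ (2 * x + 2 * a) + (2 * y + 2 * b)
  regroup = solve-∀
  square : ∀ a b → a * (a + 1) + b * (b + 1) + 2 * (a * b) ≡ suc (a + b) * (a + b)
  square = solve-∀

-- A leaf labelled nothing is one whose species lies outside the part of the species tree under consideration.
Labelling : Set
Labelling = Pos → Maybe Pos

labels : RTree → Labelling → List Pos
labels t ℓ = catMaybes (map ℓ (leavesOf t))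

allJust : ∀ {A : Set} → List (Maybe A) → ℕ
allJust [] = 1
allJust (nothing ∷ _) = 0
allJust (just _ ∷ ms) = allJust ms

allJust-++ : ∀ {A : Set} (ms ms' : List (Maybe A)) → allJust (ms ++ ms') ≡ 1 → allJust ms ≡ 1 × allJust ms' ≡ 1
allJust-++ [] ms' eq = refl , eq
allJust-++ (just _ ∷ ms) ms' eq = allJust-++ ms ms' eq

allJust-0⊎1 : ∀ {A : Set} (ms : List (Maybe A)) → allJust ms ≡ 0 ⊎ allJust ms ≡ 1
allJust-0⊎1 [] = inj₂ refl
allJust-0⊎1 (nothing ∷ ms) = inj₁ refl
allJust-0⊎1 (just _ ∷ ms) = allJust-0⊎1 ms

allJust⇒length-catMaybes : ∀ {A : Set} (ms : List (Maybe A)) → allJust ms ≡ 1 → length (catMaybes ms) ≡ length ms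
allJust⇒length-catMaybes [] _ = refl
allJust⇒length-catMaybes (just _ ∷ ms) eq = cong suc (allJust⇒length-catMaybes ms eq)

allJust-map-just : ∀ {A : Set} (xs : List A) → allJust (map just xs) ≡ 1
allJust-map-just [] = refl
allJust-map-just (x ∷ xs) = allJust-map-just xs

inChild : ℕ → Pos → Maybe Pos
inChild i [] = nothing
inChild i (j ∷ p) with j ≟ i
... | yes _ = just p
... | no _ = nothing

inChild-∷ : ∀ i p → inChild i (i ∷ p) ≡ just p
inChild-∷ i p with i ≟ i
... | yes _ = refl
... | no i≢i = contradiction refl i≢i

inChild≡just : ∀ i p {q} → inChild i p ≡ just q → p ≡ i ∷ q
inChild≡just i (j ∷ p) eq with j ≟ i | eq
... | yes refl | refl = refl

descend : ℕ → Maybe Pos → Maybe Pos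
descend i m = m >>= inChild i

catMaybes-map-descend : ∀ i ms → catMaybes (map (descend i) ms) ≡ mapMaybe (inChild i) (catMaybes ms)
catMaybes-map-descend i [] = refl
catMaybes-map-descend i (nothing ∷ ms) = catMaybes-map-descend i ms
catMaybes-map-descend i (just p ∷ ms) with inChild i p
... | nothing = catMaybes-map-descend i ms
... | just q = cong (q ∷_) (catMaybes-map-descend i ms)

labels-descend : ∀ i t ℓ → labels t (descend i ∘ ℓ) ≡ mapMaybe (inChild i) (labels t ℓ)
labels-descend i t ℓ = trans (cong catMaybes (map-∘ (leavesOf t))) (catMaybes-map-descend i (map ℓ (leavesOf t)))

rootTerm : (List (Maybe Pos) → ℕ) → RTree → Labelling → ℕ
rootTerm f (node []) ℓ = 0
rootTerm f t@(node (_ ∷ _)) ℓ = f (map ℓ (leavesOf t))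

mutual
  sumInternal : (List (Maybe Pos) → ℕ) → RTree → Labelling → ℕ
  sumInternal f t@(node ts) ℓ = rootTerm f t ℓ + sumInternalL f 0 ts ℓ

  sumInternalL : (List (Maybe Pos) → ℕ) → ℕ → List RTree → Labelling → ℕ
  sumInternalL f j [] ℓ = 0
  sumInternalL f j (t ∷ ts) ℓ = sumInternal f t (ℓ ∘ (j ∷_)) + sumInternalL f (suc j) ts ℓ

rootTerm-+ : ∀ f g t ℓ → rootTerm (λ ms → f ms + g ms) t ℓ ≡ rootTerm f t ℓ + rootTerm g t ℓ
rootTerm-+ f g (node []) ℓ = refl
rootTerm-+ f g (node (_ ∷ _)) ℓ = refl

mutual
  sumInternal-+ : ∀ f g t ℓ → sumInternal (λ ms → f ms + g ms) t ℓ ≡ sumInternal f t ℓ + sumInternal g t ℓ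
  sumInternal-+ f g t@(node ts) ℓ rewrite rootTerm-+ f g t ℓ | sumInternalL-+ f g 0 ts ℓ =
    interchange (rootTerm f t ℓ) (rootTerm g t ℓ) _ _

  sumInternalL-+ : ∀ f g j ts ℓ →
    sumInternalL (λ ms → f ms + g ms) j ts ℓ ≡ sumInternalL f j ts ℓ + sumInternalL g j ts ℓ
  sumInternalL-+ f g j [] ℓ = refl
  sumInternalL-+ f g j (t ∷ ts) ℓ rewrite sumInternal-+ f g t (ℓ ∘ (j ∷_)) | sumInternalL-+ f g (suc j) ts ℓ =
    interchange (sumInternal f t (ℓ ∘ (j ∷_))) _ _ _

rootTerm-map : ∀ f s t ℓ → rootTerm (f ∘ map s) t ℓ ≡ rootTerm f t (s ∘ ℓ)
rootTerm-map f s (node []) ℓ = refl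
rootTerm-map f s t@(node (_ ∷ _)) ℓ = cong f (sym (map-∘ (leavesOf t)))

mutual
  sumInternal-map : ∀ f s t ℓ → sumInternal (f ∘ map s) t ℓ ≡ sumInternal f t (s ∘ ℓ)
  sumInternal-map f s t@(node ts) ℓ = cong₂ _+_ (rootTerm-map f s t ℓ) (sumInternalL-map f s 0 ts ℓ)

  sumInternalL-map : ∀ f s j ts ℓ → sumInternalL (f ∘ map s) j ts ℓ ≡ sumInternalL f j ts (s ∘ ℓ)
  sumInternalL-map f s j [] ℓ = refl
  sumInternalL-map f s j (t ∷ ts) ℓ =
    cong₂ _+_ (sumInternal-map f s t (ℓ ∘ (j ∷_))) (sumInternalL-map f s (suc j) ts ℓ)

rootTerm-const-0 : ∀ t ℓ → rootTerm (λ _ → 0) t ℓ ≡ 0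
rootTerm-const-0 (node []) ℓ = refl
rootTerm-const-0 (node (_ ∷ _)) ℓ = refl

mutual
  sumInternal-const-0 : ∀ t ℓ → sumInternal (λ _ → 0) t ℓ ≡ 0
  sumInternal-const-0 t@(node ts) ℓ = cong₂ _+_ (rootTerm-const-0 t ℓ) (sumInternalL-const-0 0 ts ℓ)

  sumInternalL-const-0 : ∀ j ts ℓ → sumInternalL (λ _ → 0) j ts ℓ ≡ 0
  sumInternalL-const-0 j [] ℓ = refl
  sumInternalL-const-0 j (t ∷ ts) ℓ =
    cong₂ _+_ (sumInternal-const-0 t (ℓ ∘ (j ∷_))) (sumInternalL-const-0 (suc j) ts ℓ)

nodeTerm : (List (Maybe Pos) → ℕ) → Labelling → Pos × RTree → ℕ
nodeTerm f ℓ (v , u) = rootTerm f u (ℓ ∘ (v ++_))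

mutual
  sum-nodeTerm-nodes : ∀ f t ℓ → sum (map (nodeTerm f ℓ) (nodes t)) ≡ sumInternal f t ℓ
  sum-nodeTerm-nodes f t@(node ts) ℓ = cong (rootTerm f t ℓ +_) (sum-nodeTerm-nodesL f 0 ts ℓ)

  sum-nodeTerm-nodesL : ∀ f j ts ℓ → sum (map (nodeTerm f ℓ) (nodesL j ts)) ≡ sumInternalL f j ts ℓ
  sum-nodeTerm-nodesL f j [] ℓ = refl
  sum-nodeTerm-nodesL f j (t ∷ ts) ℓ = begin
    sum (map (nodeTerm f ℓ) (map _ (nodes t) ++ nodesL (suc j) ts))
      ≡⟨ cong sum (map-++ (nodeTerm f ℓ) (map _ (nodes t)) (nodesL (suc j) ts)) ⟩
    sum (map (nodeTerm f ℓ) (map _ (nodes t)) ++ map (nodeTerm f ℓ) (nodesL (suc j) ts))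
      ≡⟨ sum-++ (map (nodeTerm f ℓ) (map _ (nodes t))) _ ⟩
    sum (map (nodeTerm f ℓ) (map _ (nodes t))) + sum (map (nodeTerm f ℓ) (nodesL (suc j) ts))
      ≡⟨ cong₂ _+_ (trans (cong sum (sym (map-∘ (nodes t)))) (sum-nodeTerm-nodes f t (ℓ ∘ (j ∷_))))
                   (sum-nodeTerm-nodesL f (suc j) ts ℓ) ⟩
    sumInternal f t (ℓ ∘ (j ∷_)) + sumInternalL f (suc j) ts ℓ ∎
    where open ≡-Reasoning

IsGeneShapeForest : List RTree → Set
IsGeneShapeForest ts = ∀ k p us → subL ts k p ≡ just (node us) → length us ≡ 0 ⊎ 2 ≤ length us

labelsL : ℕ → List RTree → Labelling → List Pos
labelsL j ts ℓ = catMaybes (map ℓ (leavesL j ts))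

map-leavesL-∷ : ∀ (ℓ : Labelling) j t ts →
  map ℓ (leavesL j (t ∷ ts)) ≡ map (ℓ ∘ (j ∷_)) (leavesOf t) ++ map ℓ (leavesL (suc j) ts)
map-leavesL-∷ ℓ j t ts =
  trans (map-++ ℓ (map (j ∷_) (leavesOf t)) (leavesL (suc j) ts)) (cong (_++ _) (sym (map-∘ (leavesOf t))))

length-labelsL-∷ : ∀ j t ts ℓ →
  length (labelsL j (t ∷ ts) ℓ) ≡ length (labels t (ℓ ∘ (j ∷_))) + length (labelsL (suc j) ts ℓ)
length-labelsL-∷ j t ts ℓ rewrite map-leavesL-∷ ℓ j t ts
  | catMaybes-++ (map (ℓ ∘ (j ∷_)) (leavesOf t)) (map ℓ (leavesL (suc j) ts)) = length-++ (labels t (ℓ ∘ (j ∷_)))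

Σ#labels∸1 : ℕ → List RTree → Labelling → ℕ
Σ#labels∸1 j [] ℓ = 0
Σ#labels∸1 j (t ∷ ts) ℓ = (length (labels t (ℓ ∘ (j ∷_))) ∸ 1) + Σ#labels∸1 (suc j) ts ℓ

Σ#labels∸1≤ : ∀ j ts ℓ → Σ#labels∸1 j ts ℓ ≤ length (labelsL j ts ℓ) ∸ 1
Σ#labels∸1≤ j [] ℓ = z≤n
Σ#labels∸1≤ j (t ∷ ts) ℓ rewrite length-labelsL-∷ j t ts ℓ =
  ≤-trans (+-monoʳ-≤ (m ∸ 1) (Σ#labels∸1≤ (suc j) ts ℓ)) (∸1+∸1≤+∸1 m (length (labelsL (suc j) ts ℓ)))
  where
  m = length (labels t (ℓ ∘ (j ∷_)))
  ∸1+∸1≤+∸1 : ∀ a b → (a ∸ 1) + (b ∸ 1) ≤ (a + b) ∸ 1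
  ∸1+∸1≤+∸1 zero b = ≤-refl
  ∸1+∸1≤+∸1 (suc a) b = +-monoʳ-≤ a (m∸n≤m b 1)

Σ#labels∸1-allJust : ∀ j ts ℓ → allJust (map ℓ (leavesL j ts)) ≡ 1 →
  Σ#labels∸1 j ts ℓ + length ts ≡ length (labelsL j ts ℓ)
Σ#labels∸1-allJust j [] ℓ _ = refl
Σ#labels∸1-allJust j (t ∷ ts) ℓ allJ rewrite length-labelsL-∷ j t ts ℓ
  with allJ-t , allJ-ts ← allJust-++ (map (ℓ ∘ (j ∷_)) (leavesOf t)) (map ℓ (leavesL (suc j) ts))
                                     (subst (λ ms → allJust ms ≡ 1) (map-leavesL-∷ ℓ j t ts) allJ) = begin
  (m ∸ 1) + Σ#labels∸1 (suc j) ts ℓ + suc (length ts)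
    ≡⟨ +-suc _ (length ts) ⟩
  suc ((m ∸ 1) + Σ#labels∸1 (suc j) ts ℓ + length ts)
    ≡⟨ cong suc (+-assoc (m ∸ 1) _ _) ⟩
  suc (m ∸ 1) + (Σ#labels∸1 (suc j) ts ℓ + length ts)
    ≡⟨ cong₂ _+_ (m+[n∸m]≡n 1≤m) (Σ#labels∸1-allJust (suc j) ts ℓ allJ-ts) ⟩
  m + length (labelsL (suc j) ts ℓ) ∎
  where
  open ≡-Reasoning
  m = length (labels t (ℓ ∘ (j ∷_)))
  1≤m : 1 ≤ m
  1≤m rewrite allJust⇒length-catMaybes (map (ℓ ∘ (j ∷_)) (leavesOf t)) allJ-t
            | length-map (ℓ ∘ (j ∷_)) (leavesOf t) =
    ∈⇒1≤length (proj₂ (leavesOf-nonempty t))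

-- In a gene tree every internal node has at least two children, so the internal nodes all of whose
-- leaves are labelled are fewer than the labelled leaves.
sumInternal-allJust≤-node : ∀ u us ℓ → IsGeneShape (node (u ∷ us)) →
  sumInternalL allJust 0 (u ∷ us) ℓ ≤ Σ#labels∸1 0 (u ∷ us) ℓ →
  sumInternal allJust (node (u ∷ us)) ℓ ≤ length (labels (node (u ∷ us)) ℓ) ∸ 1
sumInternal-allJust≤-node u us ℓ shape children≤ with shape [] (u ∷ us) refl
... | inj₁ ()
... | inj₂ 2≤k with allJust-0⊎1 (map ℓ (leavesL 0 (u ∷ us)))
...   | inj₁ eq rewrite eq = ≤-trans children≤ (Σ#labels∸1≤ 0 (u ∷ us) ℓ)
...   | inj₂ eq rewrite eq = begin
  suc (sumInternalL allJust 0 (u ∷ us) ℓ) ≤⟨ s≤s children≤ ⟩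
  suc d                                   ≡⟨ +-comm 1 d ⟩
  d + 1                                   ≤⟨ +-monoʳ-≤ d (∸-monoˡ-≤ 1 2≤k) ⟩
  d + (length (u ∷ us) ∸ 1)               ≡⟨ +-∸-assoc d {length (u ∷ us)} (s≤s z≤n) ⟨
  (d + length (u ∷ us)) ∸ 1               ≡⟨ cong (_∸ 1) (Σ#labels∸1-allJust 0 (u ∷ us) ℓ eq) ⟩
  length (labelsL 0 (u ∷ us) ℓ) ∸ 1       ∎
  where
  open ≤-Reasoning
  d = Σ#labels∸1 0 (u ∷ us) ℓ

mutual
  sumInternal-allJust≤ : ∀ t ℓ → IsGeneShape t → sumInternal allJust t ℓ ≤ length (labels t ℓ) ∸ 1
  sumInternal-allJust≤ (node []) ℓ _ = z≤n
  sumInternal-allJust≤ (node (u ∷ us)) ℓ shape =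
    sumInternal-allJust≤-node u us ℓ shape (sumInternalL-allJust≤ 0 (u ∷ us) ℓ (λ k p → shape (k ∷ p)))

  sumInternalL-allJust≤ : ∀ j ts ℓ → IsGeneShapeForest ts →
    sumInternalL allJust j ts ℓ ≤ Σ#labels∸1 j ts ℓ
  sumInternalL-allJust≤ j [] ℓ _ = z≤n
  sumInternalL-allJust≤ j (t ∷ ts) ℓ shape =
    +-mono-≤ (sumInternal-allJust≤ t (ℓ ∘ (j ∷_)) (shape 0))
             (sumInternalL-allJust≤ (suc j) ts ℓ (shape ∘ suc))

-- When the labels are all defined and lie in S, this is the depth of their lca in S: every level at which
-- they all enter the same child contributes 1.
lcaDepth : RTree → List (Maybe Pos) → ℕ
lcaDepth (node (A ∷ B ∷ [])) ms =
  (allJust (map (descend 0) ms) + lcaDepth A (map (descend 0) ms))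
  + (allJust (map (descend 1) ms) + lcaDepth B (map (descend 1) ms))
lcaDepth _ _ = 0

map-descend-∷ : ∀ i qs → map (descend i) (map just (map (i ∷_) qs)) ≡ map just qs
map-descend-∷ i [] = refl
map-descend-∷ i (q ∷ qs) = cong₂ _∷_ (inChild-∷ i q) (map-descend-∷ i qs)

length≤lcaDepth : ∀ S → IsBinary S → ∀ a ps → 1 ≤ length ps → All (IsNode S) ps → All (_⪯ a) ps →
  length a ≤ lcaDepth S (map just ps)
length≤lcaDepth S bin [] ps _ _ _ = z≤n
length≤lcaDepth S bin (i ∷ a) ps 1≤ nodes ps⪯ with All-⪯-∷ ps ps⪯ | binaryView S bin
... | [] , refl | _ = contradiction 1≤ λ ()
... | q ∷ qs , refl | leaf with (_ , ()) ∷ _ ← nodes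
length≤lcaDepth _ _ (zero ∷ a) _ _ nodes ps⪯ | q ∷ qs , refl | node A B binA binB
  rewrite map-descend-∷ 0 qs | allJust-map-just qs =
  ≤-trans (s≤s (length≤lcaDepth A binA a (q ∷ qs) (s≤s z≤n) (All.map⁻ nodes) (All.map ⪯-∷⁻ (All.map⁻ ps⪯))))
          (m≤m+n _ _)
length≤lcaDepth _ _ (suc zero ∷ a) _ _ nodes ps⪯ | q ∷ qs , refl | node A B binA binB
  rewrite map-descend-∷ 1 qs | allJust-map-just qs =
  ≤-trans (s≤s (length≤lcaDepth B binB a (q ∷ qs) (s≤s z≤n) (All.map⁻ nodes) (All.map ⪯-∷⁻ (All.map⁻ ps⪯))))
          (m≤n+m _ _)
length≤lcaDepth _ _ (suc (suc _) ∷ a) _ _ ((_ , ()) ∷ _) _ | q ∷ qs , refl | node A B binA binB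

sumInternal-lcaDepth-node : ∀ A B G ℓ → sumInternal (lcaDepth (node (A ∷ B ∷ []))) G ℓ ≡
  (sumInternal allJust G (descend 0 ∘ ℓ) + sumInternal (lcaDepth A) G (descend 0 ∘ ℓ))
  + (sumInternal allJust G (descend 1 ∘ ℓ) + sumInternal (lcaDepth B) G (descend 1 ∘ ℓ))
sumInternal-lcaDepth-node A B G ℓ = begin
  sumInternal (lcaDepth (node (A ∷ B ∷ []))) G ℓ
    ≡⟨ sumInternal-+ (λ ms → through 0 allJust ms + through 0 (lcaDepth A) ms)
                     (λ ms → through 1 allJust ms + through 1 (lcaDepth B) ms) G ℓ ⟩
  sumInternal (λ ms → through 0 allJust ms + through 0 (lcaDepth A) ms) G ℓ
  + sumInternal (λ ms → through 1 allJust ms + through 1 (lcaDepth B) ms) G ℓ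
    ≡⟨ cong₂ _+_ (sumInternal-+ (through 0 allJust) (through 0 (lcaDepth A)) G ℓ)
                 (sumInternal-+ (through 1 allJust) (through 1 (lcaDepth B)) G ℓ) ⟩
  (sumInternal (through 0 allJust) G ℓ + sumInternal (through 0 (lcaDepth A)) G ℓ)
  + (sumInternal (through 1 allJust) G ℓ + sumInternal (through 1 (lcaDepth B)) G ℓ)
    ≡⟨ cong₂ _+_ (cong₂ _+_ (sumInternal-map allJust (descend 0) G ℓ) (sumInternal-map (lcaDepth A) (descend 0) G ℓ))
                 (cong₂ _+_ (sumInternal-map allJust (descend 1) G ℓ) (sumInternal-map (lcaDepth B) (descend 1) G ℓ)) ⟩
  (sumInternal allJust G (descend 0 ∘ ℓ) + sumInternal (lcaDepth A) G (descend 0 ∘ ℓ))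
  + (sumInternal allJust G (descend 1 ∘ ℓ) + sumInternal (lcaDepth B) G (descend 1 ∘ ℓ)) ∎
  where
  open ≡-Reasoning
  through : ℕ → (List (Maybe Pos) → ℕ) → List (Maybe Pos) → ℕ
  through i f = f ∘ map (descend i)

inChild-injective : ∀ i {p q r} → inChild i p ≡ just r → inChild i q ≡ just r → p ≡ q
inChild-injective i {p} {q} eqp eqq = trans (inChild≡just i p eqp) (sym (inChild≡just i q eqq))

mapMaybe-inChild-⊆ : ∀ {t c} i {ps} → sub t [ i ] ≡ just c → ps ⊆ leavesOf t →
  mapMaybe (inChild i) ps ⊆ leavesOf c
mapMaybe-inChild-⊆ {t} {c} i {ps} sub≡c ps⊆t {q} q∈ with p , p∈ , eq ← ∈-mapMaybe⁻ (inChild i) ps q∈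
  rewrite inChild≡just i p eq =
    ∈-leavesOf⁺ c (trans (sym (sub-++-just t [ i ] q sub≡c)) (∈-leavesOf⁻ t (ps⊆t p∈)))

sumInternal-allJust≤#internals : ∀ C → IsBinary C → ∀ G ℓ → IsGeneShape G → Unique (labels G ℓ) →
  labels G ℓ ⊆ leavesOf C → sumInternal allJust G ℓ ≤ length (internalsOf C)
sumInternal-allJust≤#internals C bin G ℓ shape uniq ⊆C = begin
  sumInternal allJust G ℓ   ≤⟨ sumInternal-allJust≤ G ℓ shape ⟩
  length (labels G ℓ) ∸ 1   ≤⟨ ∸-monoˡ-≤ 1 (Unique-length-≤ uniq ⊆C) ⟩
  length (leavesOf C) ∸ 1   ≡⟨ cong (_∸ 1) (suc-#internals≡#leaves C bin) ⟨
  length (internalsOf C)    ∎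
  where open ≤-Reasoning

sumInternal-lcaDepth≤H : ∀ S → IsBinary S → ∀ G ℓ → IsGeneShape G → Unique (labels G ℓ) →
  labels G ℓ ⊆ leavesOf S → sumInternal (lcaDepth S) G ℓ ≤ H S
sumInternal-lcaDepth≤H S bin G ℓ shape uniq ⊆S with binaryView S bin
... | leaf = ≤-reflexive (sumInternal-const-0 G ℓ)
... | node A B binA binB = begin
  sumInternal (lcaDepth (node (A ∷ B ∷ []))) G ℓ
    ≡⟨ sumInternal-lcaDepth-node A B G ℓ ⟩
  (sumInternal allJust G ℓ₀ + sumInternal (lcaDepth A) G ℓ₀)
  + (sumInternal allJust G ℓ₁ + sumInternal (lcaDepth B) G ℓ₁)
    ≤⟨ +-mono-≤ (+-mono-≤ (sumInternal-allJust≤#internals A binA G ℓ₀ shape (unique 0) (⊆child 0 refl))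
                          (sumInternal-lcaDepth≤H A binA G ℓ₀ shape (unique 0) (⊆child 0 refl)))
                (+-mono-≤ (sumInternal-allJust≤#internals B binB G ℓ₁ shape (unique 1) (⊆child 1 refl))
                          (sumInternal-lcaDepth≤H B binB G ℓ₁ shape (unique 1) (⊆child 1 refl))) ⟩
  (length (internalsOf A) + H A) + (length (internalsOf B) + H B)
    ≡⟨ H-node A B ⟨
  H (node (A ∷ B ∷ [])) ∎
  where
  open ≤-Reasoning
  ℓ₀ ℓ₁ : Labelling
  ℓ₀ = descend 0 ∘ ℓ
  ℓ₁ = descend 1 ∘ ℓ
  unique : ∀ i → Unique (labels G (descend i ∘ ℓ))
  unique i rewrite labels-descend i G ℓ = Unique-mapMaybe⁺ (inChild i) (inChild-injective i) uniq
  ⊆child : ∀ i {C} → sub (node (A ∷ B ∷ [])) [ i ] ≡ just C → labels G (descend i ∘ ℓ) ⊆ leavesOf C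
  ⊆child i sub≡C rewrite labels-descend i G ℓ = mapMaybe-inChild-⊆ i sub≡C ⊆S

module _ {S : RTree} (𝒢₁ 𝒢₂ : Reconciled S) (𝒢₂∈GS : InGS 𝒢₂) where

  private
    G₁ G₂ : RTree
    G₁ = G 𝒢₁
    G₂ = G 𝒢₂
    μ₁ μ₂ : Pos → Pos
    μ₁ = μ 𝒢₁
    μ₂ = μ 𝒢₂

  twins : Pos → List Pos
  twins v = filter (λ x → μ₂ x ∈? map μ₁ (leavesBelow G₁ v)) (leavesOf G₂)

  pathTerm : Pos → ℕ
  pathTerm v = dist (μ₁ v) (μ₂ (mMap 𝒢₁ 𝒢₂ v))

  module _ (v : Pos) {u} (sub≡u : sub G₁ v ≡ just u) where

    leavesBelow≡ : leavesBelow G₁ v ≡ map (v ++_) (leavesOf u)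
    leavesBelow≡ = cong (λ m → map (v ++_) (maybe leavesOf [] m)) sub≡u

    IsLeaf-below : ∀ {w} → w ∈ leavesOf u → IsLeaf G₁ (v ++ w)
    IsLeaf-below {w} w∈ = trans (sub-++-just G₁ v w sub≡u) (∈-leavesOf⁻ u w∈)

    ∈-twins : ∀ {w} → w ∈ leavesOf u → ∃ λ z → z ∈ twins v × IsLeaf G₂ z × μ₂ z ≡ μ₁ (v ++ w)
    ∈-twins {w} w∈ with z , z-leaf , μ₂z≡ , _ ← 𝒢₂∈GS (μ₁ (v ++ w)) (leaf-μ 𝒢₁ _ (IsLeaf-below w∈)) =
      z , ∈-filter⁺ _ (∈-leavesOf⁺ G₂ z-leaf) μ₂z∈ , z-leaf , μ₂z≡
      where
      μ₂z∈ : μ₂ z ∈ map μ₁ (leavesBelow G₁ v)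
      μ₂z∈ rewrite leavesBelow≡ | μ₂z≡ = ∈-map⁺ μ₁ (∈-map⁺ (v ++_) w∈)

    below-μ₁ : ∀ {w} → w ∈ leavesOf u → μ₁ (v ++ w) ⪯ μ₁ v
    below-μ₁ {w} w∈ = μ-mono 𝒢₁ (v ++ w) v (node [] , IsLeaf-below w∈) (u , sub≡u) (w , refl)

    below-μ₂m : ∀ {w} → w ∈ leavesOf u → μ₁ (v ++ w) ⪯ μ₂ (mMap 𝒢₁ 𝒢₂ v)
    below-μ₂m w∈ with z , z∈ , z-leaf , μ₂z≡ ← ∈-twins w∈ with w' , eq ← lcaL-⪯ (twins v) z∈ =
      subst (_⪯ μ₂ (lcaL (twins v))) μ₂z≡ (μ-mono 𝒢₂ z (lcaL (twins v)) (node [] , z-leaf) lca-node (w' , eq))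
      where
      lca-node : IsNode G₂ (lcaL (twins v))
      lca-node = IsNode-prefix G₂ (lcaL (twins v)) w' (subst (IsNode G₂) (sym eq) (node [] , z-leaf))

    pathTerm≤lcaDepth : IsBinary S → pathTerm v ≤ lcaDepth S (map just (map (μ₁ ∘ (v ++_)) (leavesOf u)))
    pathTerm≤lcaDepth bin with w , w∈ ← leavesOf-nonempty u =
      ≤-trans (dist≤⊔ (μ₁ v) _ (below-μ₁ w∈) (below-μ₂m w∈)) (⊔-lub (bound below-μ₁) (bound below-μ₂m))
      where
      bound : ∀ {a} → (∀ {w} → w ∈ leavesOf u → μ₁ (v ++ w) ⪯ a) →
        length a ≤ lcaDepth S (map just (map (μ₁ ∘ (v ++_)) (leavesOf u)))
      bound below = length≤lcaDepth S bin _ _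
        (subst (1 ≤_) (sym (length-map _ (leavesOf u))) (∈⇒1≤length w∈))
        (All.map⁺ (All.tabulate λ w∈ → node [] , leaf-μ 𝒢₁ _ (IsLeaf-below w∈)))
        (All.map⁺ (All.tabulate below))

  pathTerm-leaf : ∀ {v} → sub G₁ v ≡ just (node []) → pathTerm v ≡ 0
  pathTerm-leaf {v} sub≡leaf
    with z , z∈ , z-leaf , μ₂z≡ ← ∈-twins v sub≡leaf (here refl)
       | _ , _ , _ , twin-unique ← 𝒢₂∈GS (μ₁ (v ++ [])) (leaf-μ 𝒢₁ _ (IsLeaf-below v sub≡leaf (here refl))) = begin
    dist (μ₁ v) (μ₂ (lcaL (twins v))) ≡⟨ cong (dist (μ₁ v) ∘ μ₂) (lcaL-const (twins v) z∈ twins≡z) ⟩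
    dist (μ₁ v) (μ₂ z)                  ≡⟨ cong (dist (μ₁ v)) (trans μ₂z≡ (cong μ₁ (++-identityʳ v))) ⟩
    dist (μ₁ v) (μ₁ v)                  ≡⟨ dist-refl (μ₁ v) ⟩
    0                                   ∎
    where
    open ≡-Reasoning
    twins≡z : ∀ {x} → x ∈ twins v → x ≡ z
    twins≡z {x} x∈
      with x-leaf , μ₂x∈ ← ∈-filter⁻ (λ x → μ₂ x ∈? map μ₁ (leavesBelow G₁ v)) {xs = leavesOf G₂} x∈
      with here μ₂x≡ ← subst (λ ps → μ₂ x ∈ map μ₁ ps) (leavesBelow≡ v sub≡leaf) μ₂x∈ =
      trans (twin-unique _ (∈-leavesOf⁻ G₂ x-leaf) μ₂x≡) (sym (twin-unique z z-leaf μ₂z≡))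

  pathTerm≤nodeTerm : IsBinary S → ∀ {v u} → sub G₁ v ≡ just u →
    pathTerm v ≤ nodeTerm (lcaDepth S) (just ∘ μ₁) (v , u)
  pathTerm≤nodeTerm bin {v} {node []} sub≡u = ≤-reflexive (pathTerm-leaf sub≡u)
  pathTerm≤nodeTerm bin {v} {u@(node (_ ∷ _))} sub≡u =
    subst (pathTerm v ≤_) (cong (lcaDepth S) (sym (map-∘ (leavesOf u)))) (pathTerm≤lcaDepth v sub≡u bin)

  dpath≤H : IsBinary S → InGS 𝒢₁ → dpath 𝒢₁ 𝒢₂ ≤ H S
  dpath≤H bin 𝒢₁∈GS = begin
    sum (map pathTerm (positions G₁))
      ≡⟨ cong (sum ∘ map pathTerm) (sym (map-proj₁-nodes G₁)) ⟩
    sum (map pathTerm (map proj₁ (nodes G₁)))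
      ≡⟨ cong sum (sym (map-∘ (nodes G₁))) ⟩
    sum (map (pathTerm ∘ proj₁) (nodes G₁))
      ≤⟨ sum-mono-≤ (nodes G₁) (λ vu∈ → pathTerm≤nodeTerm bin (∈-nodes⁻ G₁ vu∈)) ⟩
    sum (map (nodeTerm (lcaDepth S) (just ∘ μ₁)) (nodes G₁))
      ≡⟨ sum-nodeTerm-nodes (lcaDepth S) G₁ (just ∘ μ₁) ⟩
    sumInternal (lcaDepth S) G₁ (just ∘ μ₁)
      ≤⟨ sumInternal-lcaDepth≤H S bin G₁ (just ∘ μ₁) (G-shape 𝒢₁) unique ⊆S ⟩
    H S ∎
    where
    open ≤-Reasoning
    labels≡ : labels G₁ (just ∘ μ₁) ≡ map μ₁ (leavesOf G₁)
    labels≡ = trans (sym (mapMaybe-map just μ₁ (leavesOf G₁))) (mapMaybe-just (map μ₁ (leavesOf G₁)))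
    μ₁-injective : ∀ {x y} → x ∈ leavesOf G₁ → y ∈ leavesOf G₁ → μ₁ x ≡ μ₁ y → x ≡ y
    μ₁-injective {x} {y} x∈ y∈ μ₁x≡μ₁y
      with _ , _ , _ , twin-unique ← 𝒢₁∈GS (μ₁ x) (leaf-μ 𝒢₁ x (∈-leavesOf⁻ G₁ x∈)) =
      trans (twin-unique x (∈-leavesOf⁻ G₁ x∈) refl) (sym (twin-unique y (∈-leavesOf⁻ G₁ y∈) (sym μ₁x≡μ₁y)))
    unique : Unique (labels G₁ (just ∘ μ₁))
    unique rewrite labels≡ = Unique-map⁺ μ₁-injective (leavesOf-unique G₁)
    ⊆S : labels G₁ (just ∘ μ₁) ⊆ leavesOf S
    ⊆S p∈ rewrite labels≡ with x , x∈ , refl ← ∈-map⁻ μ₁ p∈ =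
      ∈-leavesOf⁺ S (leaf-μ 𝒢₁ x (∈-leavesOf⁻ G₁ x∈))

lemma3 : (S : RTree) → IsBinary S → (n : ℕ) → length (leavesOf S) ≡ n → 1 ≤ n →
    (𝒢₁ 𝒢₂ : Reconciled S) → InGS 𝒢₁ → InGS 𝒢₂ →
    dpath 𝒢₁ 𝒢₂ ≤ H S × 2 * H S ≤ (n ∸ 1) * (n ∸ 2)
lemma3 S bin n #leaves≡n _ 𝒢₁ 𝒢₂ 𝒢₁∈GS 𝒢₂∈GS = dpath≤H 𝒢₁ 𝒢₂ 𝒢₂∈GS bin 𝒢₁∈GS , 2*H≤
  where
  2*H≤ : 2 * H S ≤ (n ∸ 1) * (n ∸ 2)
  2*H≤ rewrite sym #leaves≡n | sym (suc-#internals≡#leaves S bin) = 2*H≤#internals*pred S bin
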